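{- No path in $\Gamma_5$ contains $UUDD$ as a subpath; that is, there are no vertices $x,a,z,b,y$ of $\Gamma_5$ such that $x\to a$ and $a\to z$ are up-edges and $z\to b$ and $b\to y$ are down-edges.
   Context: Define sets of positive integers $R_1,R_2,\dots$ recursively: $R_1=\{2\}$; for each $k\ge 1$, if $x\in R_k$ then $(x+5)^2\in R_{k+1}$; for each $k\ge1$, if $x^2\in R_k$ (with $x$ a positive integer) then $x\in R_{k+1}$. Let $S=\bigcup_{i\ge1}R_i$. The directed graph $\Gamma_5$ has vertex set $S$ and two kinds of edges: up-edges $U$, namely $(n,(n+5)^2)$ for $n\in S$, and down-edges $D$, namely $(n^2,n)$ for $n\in S$ (with $n^2\in S$). A path is a directed walk, recorded as a word in $U$ and $D$. -}

module Defs where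

open import Data.Nat using (ℕ; suc; _+_; _*_)
open import Data.Product using (∃; _×_)
open import Relation.Binary.PropositionalEquality using (_≡_)

-- R k n : n ∈ R_k   (only k ≥ 1 is inhabited; R_1 is R 1)
-- R_1 = {2}; x ∈ R_k ⇒ (x+5)^2 ∈ R_{k+1};
-- x^2 ∈ R_k with x a positive integer ⇒ x ∈ R_{k+1}.
data R : ℕ → ℕ → Set where
  base : R 1 2
  up   : ∀ {k x} → R k x → R (suc k) ((x + 5) * (x + 5))
  down : ∀ {k x} → R k (suc x * suc x) → R (suc k) (suc x)

S : ℕ → Set
S n = ∃ λ k → R k n

UpEdge : ℕ → ℕ → Set
UpEdge m n = S m × S n × n ≡ (m + 5) * (m + 5)

DownEdge : ℕ → ℕ → Set
DownEdge m n = S m × S n × m ≡ n * n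

-- The two up-edges give z = ((x+5)² + 5)², and the two down-edges give z = (y²)².
-- Hence y² = (x+5)² + 5, which lies strictly between (x+5)² and (x+6)².
module Submission where

open import Defs
open import Data.Nat using (ℕ; suc; _+_; _*_; _≤_; _<_; s≤s; z≤n)
open import Data.Nat.Properties
open import Data.Product using (_×_; _,_)
open import Data.Empty using (⊥)
open import Relation.Nullary using (¬_; contradiction)
open import Relation.Binary using (tri<; tri≈; tri>)
open import Relation.Binary.PropositionalEquality
open import Data.Nat.Tactic.RingSolver using (solve-∀)

*-self-injective : ∀ {m n} → m * m ≡ n * n → m ≡ n
*-self-injective {m} {n} eq with <-cmp m n
... | tri< m<n _ _ = contradiction eq (<⇒≢ (*-mono-< m<n m<n))
... | tri≈ _ m≡n _ = m≡n
... | tri> _ _ m>n = contradiction eq (>⇒≢ (*-mono-< m>n m>n))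

*-self-cancel-< : ∀ m n → m * m < n * n → m < n
*-self-cancel-< m n m²<n² = ≰⇒> λ n≤m → <⇒≱ m²<n² (*-mono-≤ n≤m n≤m)

no-square-between-consecutive-squares :
  ∀ n m → n * n < m * m → m * m < suc n * suc n → ⊥
no-square-between-consecutive-squares n m n²<m² m²<[1+n]² =
  <⇒≱ m²<[1+n]² (*-mono-≤ n<m n<m)
  where
  n<m : n < m
  n<m = *-self-cancel-< n m n²<m²

square-succ : ∀ n → suc n * suc n ≡ suc (n * n + (n + n))
square-succ = solve-∀

square+k<square-succ : ∀ n {k} → k ≤ n + n → n * n + k < suc n * suc n
square+k<square-succ n {k} k≤2n = begin-strict
  n * n + k             ≤⟨ +-monoʳ-≤ (n * n) k≤2n ⟩
  n * n + (n + n)       <⟨ n<1+n _ ⟩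
  suc (n * n + (n + n)) ≡⟨ sym (square-succ n) ⟩
  suc n * suc n         ∎
  where open ≤-Reasoning

square≢square+small : ∀ n m {k} → 0 < k → k ≤ n + n → m * m ≢ n * n + k
square≢square+small n m 0<k k≤2n m²≡n²+k =
  no-square-between-consecutive-squares n m
    (subst (n * n <_) (sym m²≡n²+k) (m<m+n (n * n) 0<k))
    (subst (_< suc n * suc n) (sym m²≡n²+k) (square+k<square-succ n k≤2n))

theorem7 : (x a z b y : ℕ) →
    ¬ (UpEdge x a × UpEdge a z × DownEdge z b × DownEdge b y)
theorem7 x a z b y
  ((_ , _ , a≡[x+5]²) , (_ , _ , z≡[a+5]²) , (_ , _ , z≡b²) , (_ , _ , b≡y²)) =
  square≢square+small (x + 5) y (s≤s z≤n) 5≤2[x+5] y²≡[x+5]²+5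
  where
  5≤2[x+5] : 5 ≤ (x + 5) + (x + 5)
  5≤2[x+5] = ≤-trans (m≤n+m 5 x) (m≤m+n (x + 5) (x + 5))
  b≡a+5 : b ≡ a + 5
  b≡a+5 = *-self-injective (trans (sym z≡b²) z≡[a+5]²)
  y²≡[x+5]²+5 : y * y ≡ (x + 5) * (x + 5) + 5
  y²≡[x+5]²+5 = trans (sym b≡y²) (trans b≡a+5 (cong (_+ 5) a≡[x+5]²))
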